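{- Let $d\ge1$, let $\mathbb X$ be the set of all tableaux and $\mathbb Y_d$ the set of all tableaux whose row $d$ is identical to row $d+1$. Then $T\mapsto\alpha_d(T)$ is a bijection $\mathbb X\to\mathbb Y_d$, whose inverse deletes row $d+1$ and moves every row of index greater than $d+1$ up one row. Let $T\in\mathbb X$, $\widetilde T=\alpha_d(T)$, $l=l(T)=l(\widetilde T)$, and let $b$ be the length of row $d$ (in both $T$ and $\widetilde T$). Then: (1) The first $d$ rows of $T$ are identical to those of $\widetilde T$; in particular $b=0$ iff $T=\widetilde T$. (2) For every $j\ge d$, row $j$ of $T$ is identical to row $j+1$ of $\widetilde T$. Each of the first $b$ columns of $\widetilde T$ has length one more than the corresponding column of $T$. (3) Suppose $b>0$. Let $B$ and $\widetilde B$ be the end-boxes of the $l$-sets of $T$ and $\widetilde T$, and $x_B$ the row index of $B$. Then: (a) $x_B<d$ iff $B=\widetilde B$ iff the $l$-sets of $T$ and $\widetilde T$ are equal; (b) $x_B\ge d$ iff $\widetilde B$ is $B$ translated down one unit; (c) the $l$-set of $T$ begins in a row of index greater than $d$ iff the $l$-set of $\widetilde T$ begins in a row of index greater than $d+1$ iff the $l$-set of $\widetilde T$ is the $l$-set of $T$ translated down one unit; (d) if $x_B\ge d$, then the $l$-set of $T$ is the set of last boxes of all rows $1,\dots,x_B$ iff the $l$-set of $\widetilde T$ is the set of last boxes of all rows $1,\dots,x_B+1$. (4) Suppose the prime path of row $d$ in $T$ has height $d$ (equivalently, the prime path of row $d$ in $\widetilde T$ has height $d$). Then $T$ is a $\psi$-tableau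 iff $\widetilde T$ is a $\psi$-tableau.
   Context: Young diagrams use English notation: rows indexed $1,2,\dots$ top to bottom, columns $1,2,\dots$ left to right, $(x,y)$ the box in row $x$, column $y$, row lengths $\lambda_1\ge\lambda_2\ge\cdots$, $\lambda_j=0$ beyond the last row, $\lambda_0=+\infty$; $[m]=\{1,\dots,m\}$. For $d\ge1$, the height of the prime path of row $d$ of $Y$ is $h_Y(d)=\min\{h\ge1:\lambda_{d-h}\ge\lambda_d+h\}$. If $B$ is the last box of row $x_B$, the $B$-strip is the set of last boxes of rows $x_B-h_Y(x_B)+1,\dots,x_B$; $B$ is a corner box if it is also lowest in its column. $Y'\gtrdot Y$ if $Y'$ is $Y$ with the $B$-strip of some corner box $B$ deleted. A tableau $T$ fills a Young diagram with positive integers, rows strictly increasing left to right, columns weakly increasing downward, label set exactly $[l]$ for some $l\ge0$, $l=l(T)$ its length; the $r$-set is the set of boxes labelled $r$; $T^{(r)}$ consists of boxes with labels $\le r$. A nonempty set of boxes begins in its row of minimum index and ends in its row of maximum index; its end-box is its box in the row of maximum index. Two rows are identical if they have the same length and labels. A set $S$ of boxes translated down one unit is $\{(x+1,y):(x,y)\in S\}$. A $\psi$-tableau is a tableau with $sh(T^{(r-1)})\gtrdot sh(T^{(r)})$ for all $r\in[l(T)]$. For $d\ge1$, $\alpha_d(T)$ is obtained from a tableau $T$ by moving every row of index $>d$ down one row and placing a copy of row $d$ in row $d+1$. -}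

module Defs where

open import Data.Nat using (ℕ; zero; suc; _+_; _∸_; _≤_; _<_; _≤?_; _⊔_)
open import Data.List using (List; []; _∷_; take; drop; _++_; length; filter; foldr; concat)
open import Data.Maybe using (Maybe; just; nothing)
open import Data.Product using (Σ; _×_; ∃)
open import Data.Sum using (_⊎_)
open import Relation.Nullary using (¬_)
open import Relation.Binary.PropositionalEquality using (_≡_)
open import Function.Bundles using (_⇔_)

-- Raw tableaux: the list of rows (top to bottom), each row the list of
-- its labels (left to right).  Canonical representation: every listed
-- row is nonempty (rows beyond the last listed row are empty).
-- Rows and columns are indexed from 1; index 0 is "no row/column".

RawTableau : Set
RawTableau = List (List ℕ)

rowAt : RawTableau → ℕ → List ℕ
rowAt []       _             = []
rowAt (r ∷ rs) zero          = []
rowAt (r ∷ rs) (suc zero)    = r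
rowAt (r ∷ rs) (suc (suc n)) = rowAt rs (suc n)

at : List ℕ → ℕ → Maybe ℕ
at []       _             = nothing
at (a ∷ as) zero          = nothing
at (a ∷ as) (suc zero)    = just a
at (a ∷ as) (suc (suc n)) = at as (suc n)

entry : RawTableau → ℕ → ℕ → Maybe ℕ
entry T x y = at (rowAt T x) y

rowLen : RawTableau → ℕ → ℕ
rowLen T x = length (rowAt T x)

colLen : RawTableau → ℕ → ℕ
colLen T y = length (filter (λ r → y ≤? length r) T)

len : RawTableau → ℕ
len T = foldr _⊔_ 0 (concat T)

data NonEmpty {A : Set} : List A → Set where
  nonempty : ∀ {a as} → NonEmpty (a ∷ as)

data AllRows (P : List ℕ → Set) : RawTableau → Set where
  []  : AllRows P []
  _∷_ : ∀ {r rs} → P r → AllRows P rs → AllRows P (r ∷ rs)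

-- A tableau: positive integer labels, rows strictly increasing, columns
-- weakly increasing (which also forces the shape to be a Young diagram),
-- label set exactly [l(T)].
record IsTableau (T : RawTableau) : Set where
  field
    rowsNonEmpty : AllRows NonEmpty T
    positive     : ∀ x y a → entry T x y ≡ just a → 1 ≤ a
    rowStrict    : ∀ x y b → 1 ≤ y → entry T x (suc y) ≡ just b →
                   Σ ℕ λ a → entry T x y ≡ just a × a < b
    colWeak      : ∀ x y b → 1 ≤ x → entry T (suc x) y ≡ just b →
                   Σ ℕ λ a → entry T x y ≡ just a × a ≤ b
    labelsOnto   : ∀ r → 1 ≤ r → r ≤ len T →
                   Σ ℕ λ x → Σ ℕ λ y → entry T x y ≡ just r

RowsIdentical : RawTableau → ℕ → Set
RowsIdentical T d = rowAt T d ≡ rowAt T (suc d)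

dup : RawTableau → RawTableau
dup []       = []
dup (r ∷ rs) = r ∷ r ∷ rs

-- α_d (d ≥ 1): copy row d into row d+1, moving rows of index > d down
α : ℕ → RawTableau → RawTableau
α d T = take (d ∸ 1) T ++ dup (drop (d ∸ 1) T)

β : ℕ → RawTableau → RawTableau
β d T = take d T ++ drop (suc d) T

-- Sets of boxes as predicates on (row , column)

BoxSet : Set₁
BoxSet = ℕ → ℕ → Set

SameSet : BoxSet → BoxSet → Set
SameSet S S′ = ∀ x y → S x y ⇔ S′ x y

LSet : RawTableau → ℕ → BoxSet
LSet T r x y = entry T x y ≡ just r

IsEndBox : BoxSet → ℕ → ℕ → Set
IsEndBox S x y = S x y × (∀ x′ y′ → S x′ y′ → x′ ≤ x)

IsBeginRow : BoxSet → ℕ → Set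
IsBeginRow S x = (Σ ℕ λ y → S x y) × (∀ x′ y′ → S x′ y′ → x ≤ x′)

BeginsAfter : BoxSet → ℕ → Set
BeginsAfter S k = Σ ℕ λ x → IsBeginRow S x × k < x

ShiftDown : BoxSet → BoxSet
ShiftDown S x y = Σ ℕ λ x′ → x ≡ suc x′ × S x′ y

LastBoxesUpTo : RawTableau → ℕ → BoxSet
LastBoxesUpTo T k x y = 1 ≤ x × x ≤ k × 1 ≤ y × y ≡ rowLen T x

-- Shapes as row-length functions λ : ℕ → ℕ (only indices ≥ 1 used;
-- λ_0 = +∞ is handled in PrimeCond).

Shape : Set
Shape = ℕ → ℕ

-- condition λ_{d-h} ≥ λ_d + h, with λ_0 = +∞ (d ≤ h)
PrimeCond : Shape → ℕ → ℕ → Set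
PrimeCond λ′ d h = d ≤ h ⊎ λ′ d + h ≤ λ′ (d ∸ h)

PrimeHeight : Shape → ℕ → ℕ → Set
PrimeHeight λ′ d h =
  1 ≤ h × PrimeCond λ′ d h × (∀ h′ → 1 ≤ h′ → h′ < h → ¬ PrimeCond λ′ d h′)

-- Y′ ⋗ Y : Y′ is Y with the B-strip of some corner box B deleted
-- (B the last box of row xB, strip = last boxes of rows xB-h+1,…,xB,
--  h = h_Y(xB))
Covers : Shape → Shape → Set
Covers Y′ Y = Σ ℕ λ xB → Σ ℕ λ h →
  1 ≤ xB × 1 ≤ Y xB × Y (suc xB) < Y xB × PrimeHeight Y xB h ×
  (∀ x → 1 ≤ x → (xB < x + h × x ≤ xB) → Y′ x ≡ Y x ∸ 1) ×
  (∀ x → 1 ≤ x → ¬ (xB < x + h × x ≤ xB) → Y′ x ≡ Y x)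

shapeUpTo : RawTableau → ℕ → Shape
shapeUpTo T r x = length (filter (λ a → a ≤? r) (rowAt T x))

IsPsi : RawTableau → Set
IsPsi T = ∀ r → 1 ≤ r → r ≤ len T → Covers (shapeUpTo T (r ∸ 1)) (shapeUpTo T r)

module Submission where

-- Row x of α_d T is row x of T for x ≤ d and row x − 1 of T for x > d. So every property of
-- α_d T asked about in (1)-(3) (rows, columns, r-sets, end-boxes, beginning rows, last boxes)
-- is the corresponding property of T transported along this monotone reindexing of rows, which
-- has the right inverse x ↦ x (x ≤ d), x ↦ x + 1 (x > d).
--
-- For (4), suppose h_Y(d) = d, i.e. λ_{d−j} < λ_d + j for 0 < j < d. Then the prime path of a
-- row X ≥ d either involves only rows d,…,X (its height is at most X − d) or runs up to the top
-- (its height is at least X). Either way, duplicating row d moves it rigidly: its strip in the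
-- duplicated shape is the shifted strip, or consists of the last boxes of all rows 1,…,X + 1.
-- Hence Y′ ⋗ Y iff the duplicated shapes satisfy Ỹ′ ⋗ Ỹ. The condition h(d) = d passes from Y to
-- Y′ along a covering, so by downward induction on r it holds for every sh(T⁽ʳ⁾), and the
-- coverings sh(T⁽ʳ⁻¹⁾) ⋗ sh(T⁽ʳ⁾) transfer one by one.

open import Defs
open import Data.Nat using (ℕ; zero; suc; pred; _+_; _∸_; _⊔_; _≤_; _<_; _≤?_; _<?_; _≟_; z≤n; s≤s; z<s; NonZero; >-nonZero⁻¹)
open import Data.Nat.Properties
open import Data.List using (List; []; _∷_; length; filter; foldr; concat)
open import Data.List.Properties using (foldr-++; filter-all; filter-accept; filter-reject; ∷-injectiveʳ)
open import Data.List.Relation.Unary.All using (All; []; _∷_)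
import Data.List.Relation.Unary.All as All
import Function.Properties.Equivalence as ⇔
open import Data.Maybe using (just)
open import Data.Maybe.Properties using (just-injective)
open import Data.Product using (Σ; _×_; _,_; proj₁; proj₂; map₁; map₂)
open import Data.Sum using (inj₁; inj₂)
open import Function.Base using (_∘_)
open import Function.Bundles using (_⇔_; mk⇔; module Equivalence)
open import Relation.Nullary using (¬_; Dec; yes; no; contradiction)
open import Relation.Nullary.Decidable using (_×-dec_)
open import Relation.Binary.PropositionalEquality
open import Relation.Binary.Definitions using (tri<; tri≈; tri>)

open Equivalence using (to; from)

-- Reindexing rows

-- Row x of α d T is row predAbove d x of T; row x of T is row sucAbove d x of α d T.
predAbove : ℕ → ℕ → ℕ
predAbove d x with x ≤? d
... | yes _ = x
... | no  _ = pred x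

sucAbove : ℕ → ℕ → ℕ
sucAbove d x with x ≤? d
... | yes _ = x
... | no  _ = suc x

predAbove-≤ : ∀ {d x} → x ≤ d → predAbove d x ≡ x
predAbove-≤ {d} {x} x≤d with x ≤? d
... | yes _   = refl
... | no  x≰d = contradiction x≤d x≰d

predAbove-suc : ∀ {d j} → d ≤ j → predAbove d (suc j) ≡ j
predAbove-suc {d} {j} d≤j with suc j ≤? d
... | yes j<d = contradiction (<-≤-trans j<d d≤j) (<-irrefl refl)
... | no  _   = refl

sucAbove-≤ : ∀ {d x} → x ≤ d → sucAbove d x ≡ x
sucAbove-≤ {d} {x} x≤d with x ≤? d
... | yes _   = refl
... | no  x≰d = contradiction x≤d x≰d

sucAbove-> : ∀ {d x} → d < x → sucAbove d x ≡ suc x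
sucAbove-> {d} {x} d<x with x ≤? d
... | yes x≤d = contradiction (<-≤-trans d<x x≤d) (<-irrefl refl)
... | no  _   = refl

predAbove-sucAbove : ∀ d x → predAbove d (sucAbove d x) ≡ x
predAbove-sucAbove d x with x ≤? d
... | yes x≤d = predAbove-≤ x≤d
... | no  x≰d = predAbove-suc (<⇒≤ (≰⇒> x≰d))

data PredAboveView (d : ℕ) : ℕ → ℕ → Set where
  fixed   : ∀ {x} → x ≤ d → PredAboveView d x x
  lowered : ∀ {j} → d ≤ j → PredAboveView d (suc j) j

predAbove-view : ∀ d x → PredAboveView d x (predAbove d x)
predAbove-view d x with x ≤? d
... | yes x≤d = fixed x≤d
predAbove-view d zero    | no x≰d = contradiction z≤n x≰d
predAbove-view d (suc j) | no x≰d = lowered (≤-pred (≰⇒> x≰d))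

≤-suc-predAbove : ∀ d x → x ≤ suc (predAbove d x)
≤-suc-predAbove d x with predAbove d x | predAbove-view d x
... | _ | fixed _   = n≤1+n x
... | _ | lowered _ = ≤-refl

predAbove-mono : ∀ d {x x′} → x ≤ x′ → predAbove d x ≤ predAbove d x′
predAbove-mono d {x} {x′} x≤x′ with predAbove d x | predAbove-view d x | predAbove d x′ | predAbove-view d x′
... | _ | fixed _   | _ | fixed _    = x≤x′
... | _ | fixed x≤d | _ | lowered d≤j = ≤-trans x≤d d≤j
... | _ | lowered _ | _ | fixed _    = ≤-pred (≤-trans x≤x′ (n≤1+n _))
... | _ | lowered _ | _ | lowered _  = ≤-pred x≤x′

sucAbove-mono : ∀ d {x x′} → x ≤ x′ → sucAbove d x ≤ sucAbove d x′
sucAbove-mono d {x} {x′} x≤x′ with x ≤? d | x′ ≤? d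
... | yes _ | yes _    = x≤x′
... | yes _ | no _     = ≤-trans x≤x′ (n≤1+n x′)
... | no x≰d | yes x′≤d = contradiction (≤-trans x≤x′ x′≤d) x≰d
... | no _  | no _     = s≤s x≤x′

predAbove-pos : ∀ d .{{_ : NonZero d}} {x} → 1 ≤ x → 1 ≤ predAbove d x
predAbove-pos d {x} 1≤x with predAbove d x | predAbove-view d x
... | _ | fixed _     = 1≤x
... | _ | lowered d≤j = ≤-trans (>-nonZero⁻¹ d) d≤j

≤-sucAbove : ∀ d x → x ≤ sucAbove d x
≤-sucAbove d x with x ≤? d
... | yes _ = ≤-refl
... | no  _ = n≤1+n x

sucAbove-pos : ∀ d {x} → 1 ≤ x → 1 ≤ sucAbove d x
sucAbove-pos d {x} 1≤x = ≤-trans 1≤x (≤-sucAbove d x)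

-- Rows of α d T and β d T

rowAt-α-≤ : ∀ d .{{_ : NonZero d}} T x → x ≤ d → rowAt (α d T) x ≡ rowAt T x
rowAt-α-≤ (suc zero)    []       x             _         = refl
rowAt-α-≤ (suc zero)    (r ∷ rs) zero          _         = refl
rowAt-α-≤ (suc zero)    (r ∷ rs) (suc zero)    _         = refl
rowAt-α-≤ (suc zero)    (r ∷ rs) (suc (suc x)) (s≤s ())
rowAt-α-≤ (suc (suc d)) []       x             _         = refl
rowAt-α-≤ (suc (suc d)) (r ∷ rs) zero          _         = refl
rowAt-α-≤ (suc (suc d)) (r ∷ rs) (suc zero)    _         = refl
rowAt-α-≤ (suc (suc d)) (r ∷ rs) (suc (suc x)) (s≤s x≤d) = rowAt-α-≤ (suc d) rs (suc x) x≤d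

rowLen-α-≤ : ∀ d .{{_ : NonZero d}} T {x} → x ≤ d → rowLen (α d T) x ≡ rowLen T x
rowLen-α-≤ d T {x} x≤d = cong length (rowAt-α-≤ d T x x≤d)

rowAt-α-suc : ∀ d .{{_ : NonZero d}} T j → d ≤ j → rowAt (α d T) (suc j) ≡ rowAt T j
rowAt-α-suc (suc zero)    []       j             _         = refl
rowAt-α-suc (suc zero)    (r ∷ rs) (suc j)       _         = refl
rowAt-α-suc (suc (suc d)) []       j             _         = refl
rowAt-α-suc (suc (suc d)) (r ∷ rs) (suc (suc j)) (s≤s d≤j) = rowAt-α-suc (suc d) rs (suc j) d≤j

rowAt-α : ∀ d .{{_ : NonZero d}} T x → rowAt (α d T) x ≡ rowAt T (predAbove d x)
rowAt-α d T x with predAbove d x | predAbove-view d x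
... | _ | fixed x≤d   = rowAt-α-≤ d T x x≤d
... | _ | lowered d≤j = rowAt-α-suc d T _ d≤j

entry-α : ∀ d .{{_ : NonZero d}} T x y → entry (α d T) x y ≡ entry T (predAbove d x) y
entry-α d T x y = cong (λ r → at r y) (rowAt-α d T x)

entry-α-sucAbove : ∀ d .{{_ : NonZero d}} T x y → entry T x y ≡ entry (α d T) (sucAbove d x) y
entry-α-sucAbove d T x y =
  sym (trans (entry-α d T (sucAbove d x) y) (cong (λ z → entry T z y) (predAbove-sucAbove d x)))

β-α : ∀ d .{{_ : NonZero d}} T → β d (α d T) ≡ T
β-α (suc zero)    []       = refl
β-α (suc zero)    (r ∷ rs) = refl
β-α (suc (suc d)) []       = refl
β-α (suc (suc d)) (r ∷ rs) = cong (r ∷_) (β-α (suc d) rs)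

α-β : ∀ d .{{_ : NonZero d}} T → AllRows NonEmpty T → RowsIdentical T d → α d (β d T) ≡ T
α-β (suc zero)    []              _                _  = refl
α-β (suc zero)    (r ∷ [])        (nonempty ∷ _)   ()
α-β (suc zero)    (r ∷ r′ ∷ rs)   _                r≡r′ = cong (λ z → r ∷ z ∷ rs) r≡r′
α-β (suc (suc d)) []              _                _  = refl
α-β (suc (suc d)) (r ∷ rs)        (_ ∷ ne)         ident = cong (r ∷_) (α-β (suc d) rs ne ident)

entry-β : ∀ d .{{_ : NonZero d}} T → AllRows NonEmpty T → RowsIdentical T d →
          ∀ x y → entry (β d T) x y ≡ entry T (sucAbove d x) y
entry-β d T ne ident x y = begin
  entry (β d T) x y                            ≡⟨ cong (λ z → entry (β d T) z y) (predAbove-sucAbove d x) ⟨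
  entry (β d T) (predAbove d (sucAbove d x)) y ≡⟨ entry-α d (β d T) (sucAbove d x) y ⟨
  entry (α d (β d T)) (sucAbove d x) y         ≡⟨ cong (λ S → entry S (sucAbove d x) y) (α-β d T ne ident) ⟩
  entry T (sucAbove d x) y                     ∎
  where open ≡-Reasoning

entry-β-predAbove : ∀ d .{{_ : NonZero d}} T → AllRows NonEmpty T → RowsIdentical T d →
                    ∀ x y → entry T x y ≡ entry (β d T) (predAbove d x) y
entry-β-predAbove d T ne ident x y =
  trans (cong (λ S → entry S x y) (sym (α-β d T ne ident))) (entry-α d (β d T) x y)

AllRows-α : ∀ {P} d .{{_ : NonZero d}} T → AllRows P T → AllRows P (α d T)
AllRows-α (suc zero)    []       ps       = ps
AllRows-α (suc zero)    (r ∷ rs) (p ∷ ps) = p ∷ p ∷ ps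
AllRows-α (suc (suc d)) []       ps       = ps
AllRows-α (suc (suc d)) (r ∷ rs) (p ∷ ps) = p ∷ AllRows-α (suc d) rs ps

AllRows-β : ∀ {P} d T → AllRows P T → AllRows P (β d T)
AllRows-β zero    []       ps       = ps
AllRows-β zero    (r ∷ rs) (p ∷ ps) = ps
AllRows-β (suc d) []       ps       = ps
AllRows-β (suc d) (r ∷ rs) (p ∷ ps) = p ∷ AllRows-β d rs ps

rowMax : List ℕ → ℕ
rowMax = foldr _⊔_ 0

foldr-⊔ : ∀ e xs → foldr _⊔_ e xs ≡ rowMax xs ⊔ e
foldr-⊔ e []       = refl
foldr-⊔ e (x ∷ xs) = trans (cong (x ⊔_) (foldr-⊔ e xs)) (sym (⊔-assoc x (rowMax xs) e))

len-∷ : ∀ r rs → len (r ∷ rs) ≡ rowMax r ⊔ len rs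
len-∷ r rs = trans (foldr-++ _⊔_ 0 r (concat rs)) (foldr-⊔ (len rs) r)

len-α : ∀ d .{{_ : NonZero d}} T → len (α d T) ≡ len T
len-α (suc zero) []       = refl
len-α (suc zero) (r ∷ rs) = begin
  len (r ∷ r ∷ rs)             ≡⟨ len-∷ r (r ∷ rs) ⟩
  rowMax r ⊔ len (r ∷ rs)      ≡⟨ cong (rowMax r ⊔_) (len-∷ r rs) ⟩
  rowMax r ⊔ (rowMax r ⊔ len rs) ≡⟨ ⊔-assoc (rowMax r) (rowMax r) (len rs) ⟨
  (rowMax r ⊔ rowMax r) ⊔ len rs ≡⟨ cong (_⊔ len rs) (⊔-idem (rowMax r)) ⟩
  rowMax r ⊔ len rs            ≡⟨ len-∷ r rs ⟨
  len (r ∷ rs)                 ∎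
  where open ≡-Reasoning
len-α (suc (suc d)) []       = refl
len-α (suc (suc d)) (r ∷ rs) =
  trans (len-∷ r (α (suc d) rs)) (trans (cong (rowMax r ⊔_) (len-α (suc d) rs)) (sym (len-∷ r rs)))

len-β : ∀ d .{{_ : NonZero d}} T → AllRows NonEmpty T → RowsIdentical T d → len (β d T) ≡ len T
len-β d T ne ident = trans (sym (len-α d (β d T))) (cong len (α-β d T ne ident))

colLen-∷-≤ : ∀ y r rs → y ≤ length r → colLen (r ∷ rs) y ≡ suc (colLen rs y)
colLen-∷-≤ y r rs y≤r = cong length (filter-accept (λ r → y ≤? length r) y≤r)

colLen-∷-> : ∀ y r rs → ¬ y ≤ length r → colLen (r ∷ rs) y ≡ colLen rs y
colLen-∷-> y r rs y≰r = cong length (filter-reject (λ r → y ≤? length r) y≰r)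

colLen-α : ∀ d .{{_ : NonZero d}} T y → 1 ≤ y → y ≤ rowLen T d → colLen (α d T) y ≡ suc (colLen T y)
colLen-α (suc zero)    []       (suc y) _ ()
colLen-α (suc zero)    (r ∷ rs) y       _ y≤r = colLen-∷-≤ y r (r ∷ rs) y≤r
colLen-α (suc (suc d)) []       (suc y) _ ()
colLen-α (suc (suc d)) (r ∷ rs) y 1≤y y≤rowLen with y ≤? length r
... | yes y≤r = trans (colLen-∷-≤ y r _ y≤r)
                  (cong suc (trans (colLen-α (suc d) rs y 1≤y y≤rowLen) (sym (colLen-∷-≤ y r rs y≤r))))
... | no  y≰r = trans (colLen-∷-> y r _ y≰r)
                  (trans (colLen-α (suc d) rs y 1≤y y≤rowLen) (cong suc (sym (colLen-∷-> y r rs y≰r))))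

α-emptyRow : ∀ d .{{_ : NonZero d}} T → AllRows NonEmpty T → rowLen T d ≡ 0 → α d T ≡ T
α-emptyRow (suc zero)    []       _                _ = refl
α-emptyRow (suc zero)    (r ∷ rs) (nonempty ∷ _)   ()
α-emptyRow (suc (suc d)) []       _                _ = refl
α-emptyRow (suc (suc d)) (r ∷ rs) (_ ∷ ne)         empty = cong (r ∷_) (α-emptyRow (suc d) rs ne empty)

α-fixed⇒emptyRow : ∀ d .{{_ : NonZero d}} T → T ≡ α d T → rowLen T d ≡ 0
α-fixed⇒emptyRow (suc zero)    []       _    = refl
α-fixed⇒emptyRow (suc zero)    (r ∷ rs) T≡αT = contradiction (sym (cong length T≡αT)) 1+n≢n
α-fixed⇒emptyRow (suc (suc d)) []       _    = refl
α-fixed⇒emptyRow (suc (suc d)) (r ∷ rs) T≡αT = α-fixed⇒emptyRow (suc d) rs (∷-injectiveʳ T≡αT)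

-- Tableaux under reindexing of rows

colWeak-≤ : ∀ {T} → IsTableau T → ∀ {x} x′ {y b} → 1 ≤ x → x ≤ x′ → entry T x′ y ≡ just b →
            Σ ℕ λ a → entry T x y ≡ just a × a ≤ b
colWeak-≤ tab x′ 1≤x x≤x′ e with m≤n⇒m<n∨m≡n x≤x′
... | inj₂ refl = _ , e , ≤-refl
colWeak-≤ tab (suc j) 1≤x _ e | inj₁ (s≤s x≤j)
  with IsTableau.colWeak tab j _ _ (≤-trans 1≤x x≤j) e
... | a , e′ , a≤b = map₂ (map₂ (λ a₀≤a → ≤-trans a₀≤a a≤b)) (colWeak-≤ tab j 1≤x x≤j e′)

IsTableau-reindex : ∀ {T T′} (f g : ℕ → ℕ) → IsTableau T → AllRows NonEmpty T′ → len T′ ≡ len T →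
                    (∀ {x x′} → x ≤ x′ → f x ≤ f x′) → (∀ {x} → 1 ≤ x → 1 ≤ f x) →
                    (∀ x y → entry T′ x y ≡ entry T (f x) y) →
                    (∀ x y → entry T x y ≡ entry T′ (g x) y) → IsTableau T′
IsTableau-reindex {T} {T′} f g tab ne len≡ f-mono f-pos T′≗T∘f T≗T′∘g = record
  { rowsNonEmpty = ne
  ; positive     = λ x y a e → positive (f x) y a (back e)
  ; rowStrict    = λ x y b 1≤y e → map₂ (map₁ (trans (T′≗T∘f x y))) (rowStrict (f x) y b 1≤y (back e))
  ; colWeak      = λ x y b 1≤x e → map₂ (map₁ (trans (T′≗T∘f x y)))
                                     (colWeak-≤ tab (f (suc x)) (f-pos 1≤x) (f-mono (n≤1+n x)) (back e))
  ; labelsOnto   = λ r 1≤r r≤l → onto (labelsOnto r 1≤r (subst (r ≤_) len≡ r≤l))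
  }
  where
  open IsTableau tab
  back : ∀ {x y a} → entry T′ x y ≡ a → entry T (f x) y ≡ a
  back {x} {y} = trans (sym (T′≗T∘f x y))
  onto : ∀ {r} → (Σ ℕ λ x → Σ ℕ λ y → entry T x y ≡ just r) →
                  Σ ℕ λ x → Σ ℕ λ y → entry T′ x y ≡ just r
  onto (x , y , e) = g x , y , trans (sym (T≗T′∘g x y)) e

IsTableau-α : ∀ d .{{_ : NonZero d}} T → IsTableau T → IsTableau (α d T)
IsTableau-α d T tab =
  IsTableau-reindex (predAbove d) (sucAbove d) tab (AllRows-α d T (IsTableau.rowsNonEmpty tab)) (len-α d T)
    (predAbove-mono d) (predAbove-pos d) (entry-α d T) (entry-α-sucAbove d T)

IsTableau-β : ∀ d .{{_ : NonZero d}} T → IsTableau T → RowsIdentical T d → IsTableau (β d T)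
IsTableau-β d T tab ident =
  IsTableau-reindex (sucAbove d) (predAbove d) tab (AllRows-β d T ne) (len-β d T ne ident)
    (sucAbove-mono d) (sucAbove-pos d) (entry-β d T ne ident) (entry-β-predAbove d T ne ident)
  where ne = IsTableau.rowsNonEmpty tab

α-rowsIdentical : ∀ d .{{_ : NonZero d}} T → RowsIdentical (α d T) d
α-rowsIdentical d T = trans (rowAt-α-≤ d T d ≤-refl) (sym (rowAt-α-suc d T d ≤-refl))

-- Box sets under α

αSet : ℕ → BoxSet → BoxSet
αSet d S x y = S (predAbove d x) y

LSet-α : ∀ d .{{_ : NonZero d}} T r → SameSet (LSet (α d T) r) (αSet d (LSet T r))
LSet-α d T r x y = mk⇔ (trans (sym (entry-α d T x y))) (trans (entry-α d T x y))

rowRange-α : ∀ d .{{_ : NonZero d}} {k} → d ≤ k → ∀ x →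
             (1 ≤ x × x ≤ suc k) ⇔ (1 ≤ predAbove d x × predAbove d x ≤ k)
rowRange-α d {k} d≤k x with predAbove d x | predAbove-view d x
... | _ | fixed x≤d   = mk⇔ (map₂ (λ _ → ≤-trans x≤d d≤k)) (map₂ (λ x≤k → ≤-trans x≤k (n≤1+n k)))
... | _ | lowered d≤j = mk⇔ (λ (_ , j≤k) → ≤-trans (>-nonZero⁻¹ d) d≤j , ≤-pred j≤k)
                             (λ (_ , j≤k) → s≤s z≤n , s≤s j≤k)

LastBoxesUpTo-α : ∀ d .{{_ : NonZero d}} T {k} → d ≤ k →
                  SameSet (LastBoxesUpTo (α d T) (suc k)) (αSet d (LastBoxesUpTo T k))
LastBoxesUpTo-α d T d≤k x y = mk⇔
  (λ (1≤x , x≤k , 1≤y , y≡) → let (p , q) = to (rowRange-α d d≤k x) (1≤x , x≤k)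
                               in p , q , 1≤y , trans y≡ rowLen≡)
  (λ (p , q , 1≤y , y≡) → let (1≤x , x≤k) = from (rowRange-α d d≤k x) (p , q)
                          in 1≤x , x≤k , 1≤y , trans y≡ (sym rowLen≡))
  where
  rowLen≡ : rowLen (α d T) x ≡ rowLen T (predAbove d x)
  rowLen≡ = cong length (rowAt-α d T x)

SameSet-αSet⇔ : ∀ d {S S̃ L L̃ : BoxSet} → SameSet S̃ (αSet d S) → SameSet L̃ (αSet d L) →
                SameSet S L ⇔ SameSet S̃ L̃
SameSet-αSet⇔ d {S} {S̃} {L} {L̃} S̃≈ L̃≈ = mk⇔
  (λ S≈L x y → ⇔.trans (S̃≈ x y) (⇔.trans (S≈L (predAbove d x) y) (⇔.sym (L̃≈ x y))))
  (λ S̃≈L̃ x y → subst (λ z → S z y ⇔ L z y) (predAbove-sucAbove d x)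
                  (⇔.trans (⇔.sym (S̃≈ (sucAbove d x) y)) (⇔.trans (S̃≈L̃ (sucAbove d x) y) (L̃≈ (sucAbove d x) y))))

AtMostOnePerRow : BoxSet → Set
AtMostOnePerRow S = ∀ {x y y′} → S x y → S x y′ → y ≡ y′

isEndBox-unique : ∀ {S x y x′ y′} → AtMostOnePerRow S → IsEndBox S x y → IsEndBox S x′ y′ → x ≡ x′ × y ≡ y′
isEndBox-unique uniq (inS , max) (inS′ , max′) with ≤-antisym (max′ _ _ inS) (max _ _ inS′)
... | refl = refl , uniq inS inS′

leastWitness-from : ∀ {P : ℕ → Set} → (∀ n → Dec (P n)) → ∀ k {n} → (∀ i → i < n → ¬ P i) → P (k + n) →
                    Σ ℕ λ m → P m × (∀ i → P i → m ≤ i)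
leastWitness-from P? zero    {n} none-below Pn = n , Pn , λ i Pi → ≮⇒≥ (λ i<n → none-below i i<n Pi)
leastWitness-from {P} P? (suc k) {n} none-below Pk+n with P? n
... | yes Pn = n , Pn , λ i Pi → ≮⇒≥ (λ i<n → none-below i i<n Pi)
... | no ¬Pn = leastWitness-from P? k none-below′ (subst P (sym (+-suc k n)) Pk+n)
  where
  none-below′ : ∀ i → i < suc n → ¬ P i
  none-below′ i i<1+n with m≤n⇒m<n∨m≡n (≤-pred i<1+n)
  ... | inj₁ i<n  = none-below i i<n
  ... | inj₂ refl = ¬Pn

leastWitness : ∀ {P : ℕ → Set} → (∀ n → Dec (P n)) → ∀ {n} → P n → Σ ℕ λ m → P m × (∀ i → P i → m ≤ i)
leastWitness {P} P? {n} Pn = leastWitness-from P? n {0} (λ _ ()) (subst P (sym (+-identityʳ n)) Pn)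

module _ {d} .{{_ : NonZero d}} {S S̃ : BoxSet} (S̃≈αS : SameSet S̃ (αSet d S)) where

  private
    toS : ∀ {x y} → S̃ x y → S (predAbove d x) y
    toS = to (S̃≈αS _ _)

    fromS : ∀ {x y} → S (predAbove d x) y → S̃ x y
    fromS = from (S̃≈αS _ _)

    fromS-sucAbove : ∀ {x y} → S x y → S̃ (sucAbove d x) y
    fromS-sucAbove {x} {y} inS = fromS (subst (λ z → S z y) (sym (predAbove-sucAbove d x)) inS)

    fromS-≤ : ∀ {x y} → x ≤ d → S x y → S̃ x y
    fromS-≤ {x} {y} x≤d inS = fromS (subst (λ z → S z y) (sym (predAbove-≤ x≤d)) inS)

    fromS-suc : ∀ {x y} → d ≤ x → S x y → S̃ (suc x) y
    fromS-suc {x} {y} d≤x inS = fromS (subst (λ z → S z y) (sym (predAbove-suc d≤x)) inS)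

  isEndBox-α-< : ∀ {x y} → IsEndBox S x y → x < d → IsEndBox S̃ x y
  isEndBox-α-< {x} (inS , max) x<d = fromS-≤ (<⇒≤ x<d) inS , max′
    where
    max′ : ∀ x′ y′ → S̃ x′ y′ → x′ ≤ x
    max′ x′ y′ inS̃ with predAbove d x′ | predAbove-view d x′ | max _ _ (toS inS̃)
    ... | _ | fixed _     | x′≤x = x′≤x
    ... | _ | lowered d≤j | j≤x  = contradiction (≤-<-trans (≤-trans d≤j j≤x) x<d) (<-irrefl refl)

  isEndBox-α-≥ : ∀ {x y} → IsEndBox S x y → d ≤ x → IsEndBox S̃ (suc x) y
  isEndBox-α-≥ (inS , max) d≤x =
    fromS-suc d≤x inS , λ x′ y′ inS̃ → ≤-trans (≤-suc-predAbove d x′) (s≤s (max _ _ (toS inS̃)))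

  beginsAfter-α⇔ : BeginsAfter S d ⇔ BeginsAfter S̃ (suc d)
  beginsAfter-α⇔ = mk⇔ forth back
    where
    forth : BeginsAfter S d → BeginsAfter S̃ (suc d)
    forth (x , ((y , inS) , min) , d<x) = suc x , ((y , fromS-suc (<⇒≤ d<x) inS) , min′) , s≤s d<x
      where
      min′ : ∀ x′ y′ → S̃ x′ y′ → suc x ≤ x′
      min′ x′ y′ inS̃ with predAbove d x′ | predAbove-view d x′ | min _ _ (toS inS̃)
      ... | _ | fixed x′≤d | x≤x′ = contradiction (<-≤-trans d<x (≤-trans x≤x′ x′≤d)) (<-irrefl refl)
      ... | _ | lowered _  | x≤j  = s≤s x≤j
    back : BeginsAfter S̃ (suc d) → BeginsAfter S d
    back (suc x , ((y , inS̃) , min) , s≤s d<x) =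
      x , ((y , subst (λ z → S z y) (predAbove-suc (<⇒≤ d<x)) (toS inS̃)) , min′) , d<x
      where
      min′ : ∀ x′ y′ → S x′ y′ → x ≤ x′
      min′ x′ y′ inS with ≤-<-connex x′ d | min _ _ (fromS-sucAbove inS)
      ... | inj₁ x′≤d | x<σx′ =
        contradiction d<x (<-asym (≤-trans (subst (suc x ≤_) (sucAbove-≤ x′≤d) x<σx′) x′≤d))
      ... | inj₂ d<x′ | x<σx′ = ≤-pred (subst (suc x ≤_) (sucAbove-> d<x′) x<σx′)

  beginsAfter-α⇒shiftDown : BeginsAfter S̃ (suc d) → SameSet S̃ (ShiftDown S)
  beginsAfter-α⇒shiftDown (x₀ , (_ , min) , d+1<x₀) x y = mk⇔ forth back
    where
    forth : ∀ {x} → S̃ x y → ShiftDown S x y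
    forth {zero}  inS̃ = contradiction (≤-trans d+1<x₀ (min _ _ inS̃)) λ ()
    forth {suc x} inS̃ =
      x , refl , subst (λ z → S z y) (predAbove-suc (<⇒≤ (≤-pred (≤-trans d+1<x₀ (min _ _ inS̃))))) (toS inS̃)
    back : ∀ {x} → ShiftDown S x y → S̃ x y
    back (x′ , refl , inS) with ≤-<-connex x′ d
    ... | inj₁ x′≤d = contradiction (≤-trans (min _ _ (fromS-≤ x′≤d inS)) x′≤d) (<⇒≱ (<-trans (n<1+n d) d+1<x₀))
    ... | inj₂ d<x′ = fromS-suc (<⇒≤ d<x′) inS

  shiftDown⇒beginsAfter-α : (∀ x → Dec (Σ ℕ λ y → S̃ x y)) → ∀ {x y} → S̃ x y →
                            SameSet S̃ (ShiftDown S) → BeginsAfter S̃ (suc d)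
  shiftDown⇒beginsAfter-α rows? inS̃ S̃≈shift with leastWitness rows? (_ , inS̃)
  ... | m , (y₀ , inS̃m) , least with to (S̃≈shift m y₀) inS̃m
  ...   | x′ , refl , inS with ≤-<-connex x′ d
  ...     | inj₁ x′≤d = contradiction (least x′ (y₀ , fromS-≤ x′≤d inS)) (<-irrefl refl)
  ...     | inj₂ d<x′ = suc x′ , ((y₀ , inS̃m) , λ x y inS̃′ → least x (y , inS̃′)) , s≤s d<x′

  module _ (uniq : AtMostOnePerRow S̃) {xB yB xB′ yB′}
           (endS : IsEndBox S xB yB) (endS̃ : IsEndBox S̃ xB′ yB′) where

    endBox-below⇔fixed : xB < d ⇔ (xB ≡ xB′ × yB ≡ yB′)
    endBox-below⇔fixed = mk⇔
      (λ xB<d → isEndBox-unique uniq (isEndBox-α-< endS xB<d) endS̃)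
      (λ (xB≡xB′ , _) → ≰⇒> λ d≤xB →
         1+n≢n (trans (proj₁ (isEndBox-unique uniq (isEndBox-α-≥ endS d≤xB) endS̃)) (sym xB≡xB′)))

    endBox-fixed⇔sameSet : (xB ≡ xB′ × yB ≡ yB′) ⇔ SameSet S S̃
    endBox-fixed⇔sameSet = mk⇔ forth back
      where
      forth : (xB ≡ xB′ × yB ≡ yB′) → SameSet S S̃
      forth same@(xB≡xB′ , _) x y = mk⇔
        (λ inS → fromS-≤ (≤-trans (proj₂ endS x y inS) xB≤d) inS)
        (λ inS̃ → subst (λ z → S z y)
                       (predAbove-≤ (≤-trans (subst (x ≤_) (sym xB≡xB′) (proj₂ endS̃ x y inS̃)) xB≤d))
                       (toS inS̃))
        where xB≤d = <⇒≤ (from endBox-below⇔fixed same)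
      back : SameSet S S̃ → xB ≡ xB′ × yB ≡ yB′
      back S≈S̃ = isEndBox-unique uniq
        (to (S≈S̃ xB yB) (proj₁ endS) , λ x y inS̃ → proj₂ endS x y (from (S≈S̃ x y) inS̃)) endS̃

    endBox-above⇔shifted : d ≤ xB ⇔ (xB′ ≡ suc xB × yB′ ≡ yB)
    endBox-above⇔shifted = mk⇔
      (λ d≤xB → let (p , q) = isEndBox-unique uniq (isEndBox-α-≥ endS d≤xB) endS̃ in sym p , sym q)
      (λ (xB′≡ , _) → ≮⇒≥ λ xB<d →
         1+n≢n (sym (trans (proj₁ (isEndBox-unique uniq (isEndBox-α-< endS xB<d) endS̃)) xB′≡)))

-- The r-set of a tableau

at-pos : ∀ xs {y a} → at xs y ≡ just a → 1 ≤ y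
at-pos []      ()
at-pos (_ ∷ _) {zero}  ()
at-pos (_ ∷ _) {suc _} _ = s≤s z≤n

at? : ∀ xs a → Dec (Σ ℕ λ y → at xs y ≡ just a)
at? []       a = no λ ()
at? (b ∷ bs) a with b ≟ a | at? bs a
... | yes refl | _               = yes (1 , refl)
... | no  _    | yes (zero , e)  = contradiction (at-pos bs e) λ ()
... | no  _    | yes (suc y , e) = yes (suc (suc y) , e)
... | no  b≢a  | no  absent      = no λ where
  (suc zero , e)    → b≢a (just-injective e)
  (suc (suc y) , e) → absent (suc y , e)

rowStrict-< : ∀ {T} → IsTableau T → ∀ {x y} y′ {b} → 1 ≤ y → y < y′ → entry T x y′ ≡ just b →
              Σ ℕ λ a → entry T x y ≡ just a × a < b
rowStrict-< tab (suc j) 1≤y (s≤s y≤j) e with IsTableau.rowStrict tab _ j _ (≤-trans 1≤y y≤j) e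
... | a , e′ , a<b with m≤n⇒m<n∨m≡n y≤j
...   | inj₂ refl = a , e′ , a<b
...   | inj₁ y<j  = map₂ (map₂ (λ a₀<a → <-trans a₀<a a<b)) (rowStrict-< tab j 1≤y y<j e′)

LSet-atMostOnePerRow : ∀ {T} → IsTableau T → ∀ r → AtMostOnePerRow (LSet T r)
LSet-atMostOnePerRow {T} tab r e e′ = ≤-antisym (≮⇒≥ (no-repeat e′ e)) (≮⇒≥ (no-repeat e e′))
  where
  no-repeat : ∀ {x y y′} → LSet T r x y → LSet T r x y′ → ¬ y < y′
  no-repeat {x} e e′ y<y′ with rowStrict-< tab _ (at-pos (rowAt T x) e) y<y′ e′
  ... | a , ea , a<r = <-irrefl (just-injective (trans (sym ea) e)) a<r

-- Prime heights and coverings of shapes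

InStrip : ℕ → ℕ → ℕ → Set
InStrip X h x = X < x + h × x ≤ X

inStrip? : ∀ X h x → Dec (InStrip X h x)
inStrip? X h x = (X <? x + h) ×-dec (x ≤? X)

PrimeCond-cong : ∀ {Y Z X k} → (∀ x → x ≤ X → Y x ≡ Z x) → PrimeCond Y X k → PrimeCond Z X k
PrimeCond-cong         _   (inj₁ X≤k)  = inj₁ X≤k
PrimeCond-cong {X = X} {k} Y≡Z (inj₂ long) =
  inj₂ (subst₂ (λ u v → u + k ≤ v) (Y≡Z X ≤-refl) (Y≡Z (X ∸ k) (m∸n≤m X k)) long)

PrimeHeight-cong : ∀ {Y Z X h} → (∀ x → x ≤ X → Y x ≡ Z x) → PrimeHeight Y X h → PrimeHeight Z X h
PrimeHeight-cong Y≡Z (1≤h , cond , min) =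
  1≤h , PrimeCond-cong Y≡Z cond ,
  λ h′ 1≤h′ h′<h → min h′ 1≤h′ h′<h ∘ PrimeCond-cong (λ x x≤X → sym (Y≡Z x x≤X))

excess-bound : ∀ d e k → e + k ≤ d + e → k ≤ d
excess-bound d e k e+k≤d+e = +-cancelˡ-≤ e k d (subst (e + k ≤_) (+-comm d e) e+k≤d+e)

∸1-<-∸1+ : ∀ {a b j} → a < b + j → 1 ≤ j → a ∸ 1 < (b ∸ 1) + j
∸1-<-∸1+ {a}     {zero}  a<j 1≤j = ≤-<-trans (m∸n≤m a 1) a<j
∸1-<-∸1+ {zero}  {suc b} _   1≤j = ≤-trans 1≤j (m≤n+m _ b)
∸1-<-∸1+ {suc a} {suc b} a<b+j _ = ≤-pred a<b+j

PrimeCond-transfer : ∀ {Z W X′ X k} → k < X′ → k < X → Z X′ ≡ W X → Z (X′ ∸ k) ≡ W (X ∸ k) →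
                     PrimeCond Z X′ k ⇔ PrimeCond W X k
PrimeCond-transfer {k = k} k<X′ k<X top≡ apex≡ = mk⇔
  (λ where (inj₁ X′≤k) → contradiction X′≤k (<⇒≱ k<X′)
           (inj₂ long) → inj₂ (subst₂ (λ u v → u + k ≤ v) top≡ apex≡ long))
  (λ where (inj₁ X≤k)  → contradiction X≤k (<⇒≱ k<X)
           (inj₂ long) → inj₂ (subst₂ (λ u v → u + k ≤ v) (sym top≡) (sym apex≡) long))

StripDeleted : Shape → Shape → ℕ → ℕ → Set
StripDeleted Y′ Y X h = (∀ x → 1 ≤ x → InStrip X h x → Y′ x ≡ Y x ∸ 1)
                      × (∀ x → 1 ≤ x → ¬ InStrip X h x → Y′ x ≡ Y x)

StripRel : ℕ → ℕ → ℕ → ℕ → ℕ → Set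
StripRel d X h X̃ h̃ = ∀ x → 1 ≤ x → InStrip X̃ h̃ x ⇔ InStrip X h (predAbove d x)

module _ {d} .{{_ : NonZero d}} where

  stripRel-below : ∀ {X h} → X < d → StripRel d X h X h
  stripRel-below {X} X<d x _ with predAbove d x | predAbove-view d x
  ... | _ | fixed _     = ⇔.refl
  ... | _ | lowered d≤j = mk⇔ (λ (_ , j+1≤X) → contradiction (≤-trans (n≤1+n _) j+1≤X) (too-low d≤j))
                              (λ (_ , j≤X) → contradiction j≤X (too-low d≤j))
    where
    too-low : ∀ {j} → d ≤ j → ¬ j ≤ X
    too-low d≤j j≤X = <⇒≱ X<d (≤-trans d≤j j≤X)

  stripRel-short : ∀ e {h} → h ≤ e → StripRel d (d + e) h (suc (d + e)) h
  stripRel-short e {h} h≤e x _ with predAbove d x | predAbove-view d x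
  ... | _ | fixed x≤d = mk⇔ (λ (X<x+h , _) → contradiction (<-trans (n<1+n _) X<x+h) (low x≤d))
                            (λ (X<x+h , _) → contradiction X<x+h (low x≤d))
    where
    low : ∀ {x} → x ≤ d → ¬ d + e < x + h
    low x≤d = ≤⇒≯ (+-mono-≤ x≤d h≤e)
  ... | _ | lowered _ = mk⇔ (λ (X<x+h , x≤X) → ≤-pred X<x+h , ≤-pred x≤X)
                            (λ (X<x+h , x≤X) → s≤s X<x+h , s≤s x≤X)

  stripRel-full : ∀ {X h h̃} → d ≤ X → X ≤ h → suc X ≤ h̃ → StripRel d X h (suc X) h̃
  stripRel-full {X} {h} {h̃} d≤X X≤h X+1≤h̃ x 1≤x = mk⇔
    (λ (_ , x≤X+1) → ≤-trans (s≤s X≤h) (+-monoˡ-≤ h (predAbove-pos d 1≤x)) ,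
                     proj₂ (to (rowRange-α d d≤X x) (1≤x , x≤X+1)))
    (λ (_ , πx≤X) → ≤-trans (s≤s X+1≤h̃) (+-monoˡ-≤ h̃ 1≤x) ,
                    proj₂ (from (rowRange-α d d≤X x) (predAbove-pos d 1≤x , πx≤X)))

  stripDeleted-α⇔ : ∀ {Y Ỹ Y′ Ỹ′ X h X̃ h̃} →
                    (∀ x → Ỹ x ≡ Y (predAbove d x)) → (∀ x → Ỹ′ x ≡ Y′ (predAbove d x)) →
                    StripRel d X h X̃ h̃ → StripDeleted Y′ Y X h ⇔ StripDeleted Ỹ′ Ỹ X̃ h̃
  stripDeleted-α⇔ {Y} {Ỹ} {Y′} {Ỹ′} {X} {h} {X̃} {h̃} Ỹ≗ Ỹ′≗ rel = mk⇔ forth back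
    where
    forth : StripDeleted Y′ Y X h → StripDeleted Ỹ′ Ỹ _ _
    forth (inside , outside) =
      (λ x 1≤x s → trans (Ỹ′≗ x)
                     (trans (inside _ (predAbove-pos d 1≤x) (to (rel x 1≤x) s)) (cong (_∸ 1) (sym (Ỹ≗ x))))) ,
      (λ x 1≤x ¬s → trans (Ỹ′≗ x)
                      (trans (outside _ (predAbove-pos d 1≤x) (¬s ∘ from (rel x 1≤x))) (sym (Ỹ≗ x))))
    back : StripDeleted Ỹ′ Ỹ _ _ → StripDeleted Y′ Y X h
    back (inside , outside) =
      (λ x 1≤x s → via {_∸ 1} x (inside _ (sucAbove-pos d 1≤x) (from (rel-sucAbove x 1≤x) s))) ,
      (λ x 1≤x ¬s → via {λ n → n} x (outside _ (sucAbove-pos d 1≤x) (¬s ∘ to (rel-sucAbove x 1≤x))))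
      where
      rel-sucAbove : ∀ x → 1 ≤ x → InStrip X̃ h̃ (sucAbove d x) ⇔ InStrip X h x
      rel-sucAbove x 1≤x = subst (λ z → InStrip X̃ h̃ (sucAbove d x) ⇔ InStrip X h z) (predAbove-sucAbove d x)
                                 (rel _ (sucAbove-pos d 1≤x))
      via : ∀ {f : ℕ → ℕ} x → Ỹ′ (sucAbove d x) ≡ f (Ỹ (sucAbove d x)) → Y′ x ≡ f (Y x)
      via {f} x e = begin
        Y′ x                               ≡⟨ cong Y′ (predAbove-sucAbove d x) ⟨
        Y′ (predAbove d (sucAbove d x))    ≡⟨ Ỹ′≗ (sucAbove d x) ⟨
        Ỹ′ (sucAbove d x)                  ≡⟨ e ⟩
        f (Ỹ (sucAbove d x))               ≡⟨ cong f (trans (Ỹ≗ (sucAbove d x)) (cong Y (predAbove-sucAbove d x))) ⟩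
        f (Y x)                            ∎
        where open ≡-Reasoning

Reach : Shape → ℕ → ℕ → Set
Reach Y d e = Y d ≤ Y (d + e) + e

reach : ∀ Y {d} e → (1 ≤ e → ¬ PrimeCond Y (d + e) e) → Reach Y d e
reach Y {d} zero    _     = subst (λ z → Y d ≤ Y z + 0) (sym (+-identityʳ d)) (m≤m+n (Y d) 0)
reach Y {d} (suc e) ¬cond = <⇒≤ (≰⇒> λ long → ¬cond (s≤s z≤n)
  (inj₂ (subst (λ z → Y (d + suc e) + suc e ≤ Y z) (sym (m+n∸n≡m d (suc e))) long)))

module _ {d} .{{_ : NonZero d}} {Y : Shape} (hY : PrimeHeight Y d d) where

  rowAbove-d-< : ∀ j → 1 ≤ j → j < d → Y (d ∸ j) < Y d + j
  rowAbove-d-< j 1≤j j<d = ≰⇒> λ long → proj₂ (proj₂ hY) j 1≤j j<d (inj₂ long)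

  rowAbove-d-≤ : ∀ j → j < d → Y (d ∸ j) ≤ Y d + j
  rowAbove-d-≤ zero    _   = m≤m+n (Y d) 0
  rowAbove-d-≤ (suc j) j<d = <⇒≤ (rowAbove-d-< (suc j) (s≤s z≤n) j<d)

  reach⇒¬PrimeCond : ∀ {e} → Reach Y d e → ∀ j → 1 ≤ j → j < d → ¬ PrimeCond Y (d + e) (e + j)
  reach⇒¬PrimeCond {e} _ j _ j<d (inj₁ d+e≤e+j) =
    <⇒≱ j<d (+-cancelˡ-≤ e d j (subst (_≤ e + j) (+-comm d e) d+e≤e+j))
  reach⇒¬PrimeCond {e} r j 1≤j j<d (inj₂ long) = <⇒≱ (rowAbove-d-< j 1≤j j<d) (begin
    Y d + j                ≤⟨ +-monoˡ-≤ j r ⟩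
    Y (d + e) + e + j      ≡⟨ +-assoc (Y (d + e)) e j ⟩
    Y (d + e) + (e + j)    ≤⟨ long ⟩
    Y (d + e ∸ (e + j))    ≡⟨ cong Y (trans (cong (_∸ (e + j)) (+-comm d e)) ([m+n]∸[m+o]≡n∸o e d j)) ⟩
    Y (d ∸ j)              ∎)
    where open ≤-Reasoning

  primeHeight-≥ : ∀ {e h} → PrimeHeight Y (d + e) h → e < h → d + e ≤ h
  primeHeight-≥ {e} {h} (_ , cond , min) e<h with d + e ≤? h | m≤n⇒∃[o]m+o≡n e<h
  ... | yes d+e≤h | _        = d+e≤h
  ... | no  d+e≰h | k , refl = contradiction (subst (PrimeCond Y (d + e)) (sym (+-suc e k)) cond)
    (reach⇒¬PrimeCond (reach Y e λ 1≤e → min e 1≤e e<h) (suc k) (s≤s z≤n)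
      (+-cancelˡ-< e (suc k) d (subst₂ _<_ (sym (+-suc e k)) (+-comm d e) (≰⇒> d+e≰h))))

  primeHeight-reachesTop : ∀ {X h} → d ≤ X → PrimeHeight Y X h → X < d + h → X ≤ h
  primeHeight-reachesTop {h = h} d≤X hX X<d+h with m≤n⇒∃[o]m+o≡n d≤X
  ... | e , refl = primeHeight-≥ hX (+-cancelˡ-< d e h X<d+h)

  primeHeight-d-cover : ∀ {Y′} → Covers Y′ Y → PrimeHeight Y′ d d
  primeHeight-d-cover {Y′} (xB , h , _ , _ , _ , hxB , inside , outside) = 1≤d , inj₁ ≤-refl , no-lower
    where
    1≤d : 1 ≤ d
    1≤d = >-nonZero⁻¹ d
    shrinks : ∀ x → 1 ≤ x → Y′ x ≤ Y x
    shrinks x 1≤x with inStrip? xB h x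
    ... | yes s  = subst (_≤ Y x) (sym (inside x 1≤x s)) (m∸n≤m (Y x) 1)
    ... | no  ¬s = ≤-reflexive (outside x 1≤x ¬s)
    no-lower : ∀ j → 1 ≤ j → j < d → ¬ PrimeCond Y′ d j
    no-lower j _ j<d (inj₁ d≤j) = <⇒≱ j<d d≤j
    no-lower j 1≤j j<d (inj₂ long) with inStrip? xB h d
    ... | no ¬s = <⇒≱ (rowAbove-d-< j 1≤j j<d)
                    (≤-trans (subst (λ u → u + j ≤ Y′ (d ∸ j)) (outside d 1≤d ¬s) long)
                             (shrinks (d ∸ j) (m<n⇒0<n∸m j<d)))
    ... | yes s@(xB<d+h , d≤xB) = <⇒≱ (∸1-<-∸1+ (rowAbove-d-< j 1≤j j<d) 1≤j)
                    (subst₂ (λ u v → u + j ≤ v) (inside d 1≤d s) (inside (d ∸ j) (m<n⇒0<n∸m j<d) s′) long)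
      where
      s′ : InStrip xB h (d ∸ j)
      s′ = <-≤-trans (s≤s (primeHeight-reachesTop d≤xB hxB xB<d+h)) (+-monoˡ-≤ h (m<n⇒0<n∸m j<d)) ,
           ≤-trans (m∸n≤m d j) d≤xB

  module _ {Ỹ : Shape} (Ỹ≗ : ∀ x → Ỹ x ≡ Y (predAbove d x)) where

    private
      Ỹ-≤ : ∀ {x} → x ≤ d → Ỹ x ≡ Y x
      Ỹ-≤ x≤d = trans (Ỹ≗ _) (cong Y (predAbove-≤ x≤d))

      Ỹ-suc : ∀ {j} → d ≤ j → Ỹ (suc j) ≡ Y j
      Ỹ-suc d≤j = trans (Ỹ≗ _) (cong Y (predAbove-suc d≤j))

    primeCond-α-short : ∀ e {k} → k ≤ e → PrimeCond Ỹ (suc (d + e)) k ⇔ PrimeCond Y (d + e) k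
    primeCond-α-short e {k} k≤e = PrimeCond-transfer {Ỹ} {Y} (<-trans k<X (n<1+n _)) k<X (Ỹ-suc (m≤m+n d e)) apex≡
      where
      k<X : k < d + e
      k<X = <-≤-trans (s≤s k≤e) (+-monoˡ-≤ e (>-nonZero⁻¹ d))
      apex≡ : Ỹ (suc (d + e) ∸ k) ≡ Y (d + e ∸ k)
      apex≡ = trans (cong Ỹ (+-∸-assoc 1 (<⇒≤ k<X)))
                    (Ỹ-suc (subst (d ≤_) (sym (+-∸-assoc d k≤e)) (m≤m+n d (e ∸ k))))

    reach⇒¬PrimeCond-α : ∀ {e} → Reach Y d e → ∀ j → j < d → ¬ PrimeCond Ỹ (suc (d + e)) (e + suc j)
    reach⇒¬PrimeCond-α {e} _ j j<d (inj₁ X≤e+j+1) =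
      <⇒≱ j<d (+-cancelˡ-≤ e d j (subst (_≤ e + j) (+-comm d e) (≤-pred (subst (suc (d + e) ≤_) (+-suc e j) X≤e+j+1))))
    reach⇒¬PrimeCond-α {e} r j j<d (inj₂ long) = <⇒≱ (begin-strict
      Ỹ (suc (d + e) ∸ (e + suc j)) ≡⟨ cong Ỹ apex≡ ⟩
      Ỹ (d ∸ j)                     ≡⟨ Ỹ-≤ (m∸n≤m d j) ⟩
      Y (d ∸ j)                     ≤⟨ rowAbove-d-≤ j j<d ⟩
      Y d + j                       ≤⟨ +-monoˡ-≤ j r ⟩
      Y (d + e) + e + j             ≡⟨ +-assoc (Y (d + e)) e j ⟩
      Y (d + e) + (e + j)           <⟨ +-monoʳ-< (Y (d + e)) (+-monoʳ-< e (n<1+n j)) ⟩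
      Y (d + e) + (e + suc j)       ≡⟨ cong (_+ (e + suc j)) (Ỹ-suc (m≤m+n d e)) ⟨
      Ỹ (suc (d + e)) + (e + suc j) ∎) long
      where
      open ≤-Reasoning
      apex≡ : suc (d + e) ∸ (e + suc j) ≡ d ∸ j
      apex≡ = trans (cong (suc (d + e) ∸_) (+-suc e j))
                    (trans (cong (_∸ (e + j)) (+-comm d e)) ([m+n]∸[m+o]≡n∸o e d j))

    private
      exceeds : ∀ {e h} → e < h → Σ ℕ λ k → h ≡ e + suc k
      exceeds {e} e<h with k , refl ← m≤n⇒∃[o]m+o≡n e<h = k , sym (+-suc e k)

    primeHeight-α-fwd : ∀ e {h} → PrimeHeight Y (d + e) h →
                        Σ ℕ λ h̃ → PrimeHeight Ỹ (suc (d + e)) h̃ × StripRel d (d + e) h (suc (d + e)) h̃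
    primeHeight-α-fwd e {h} hX@(1≤h , cond , min) with h ≤? e
    ... | yes h≤e = h , (1≤h , from (primeCond-α-short e h≤e) cond ,
                         λ h′ 1≤h′ h′<h → min h′ 1≤h′ h′<h
                                           ∘ to (primeCond-α-short e (≤-trans (<⇒≤ h′<h) h≤e))) ,
                    stripRel-short e h≤e
    ... | no  h≰e = suc (d + e) , (s≤s z≤n , inj₁ ≤-refl , no-lower) ,
                    stripRel-full (m≤m+n d e) (primeHeight-≥ hX e<h) ≤-refl
      where
      e<h : e < h
      e<h = ≰⇒> h≰e
      no-lower : ∀ h′ → 1 ≤ h′ → h′ < suc (d + e) → ¬ PrimeCond Ỹ (suc (d + e)) h′
      no-lower h′ 1≤h′ h′<X with h′ ≤? e
      ... | yes h′≤e = min h′ 1≤h′ (≤-<-trans h′≤e e<h) ∘ to (primeCond-α-short e h′≤e)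
      ... | no  h′≰e with k , refl ← exceeds (≰⇒> h′≰e) =
        reach⇒¬PrimeCond-α (reach Y e λ 1≤e → min e 1≤e e<h) k (excess-bound d e (suc k) (≤-pred h′<X))

    primeHeight-α-bwd : ∀ e {h̃} → PrimeHeight Ỹ (suc (d + e)) h̃ →
                        Σ ℕ λ h → PrimeHeight Y (d + e) h × StripRel d (d + e) h (suc (d + e)) h̃
    primeHeight-α-bwd e {h̃} (1≤h̃ , cond , min) with h̃ ≤? e
    ... | yes h̃≤e = h̃ , (1≤h̃ , to (primeCond-α-short e h̃≤e) cond ,
                         λ h′ 1≤h′ h′<h̃ → min h′ 1≤h′ h′<h̃
                                           ∘ from (primeCond-α-short e (≤-trans (<⇒≤ h′<h̃) h̃≤e))) ,
                    stripRel-short e h̃≤e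
    ... | no  h̃≰e = d + e , (≤-trans (>-nonZero⁻¹ d) (m≤m+n d e) , inj₁ ≤-refl , no-lower) ,
                    stripRel-full (m≤m+n d e) ≤-refl X<h̃
      where
      e<h̃ : e < h̃
      e<h̃ = ≰⇒> h̃≰e
      r : Reach Y d e
      r = reach Y e λ 1≤e → min e 1≤e e<h̃ ∘ from (primeCond-α-short e ≤-refl)
      X<h̃ : suc (d + e) ≤ h̃
      X<h̃ with suc (d + e) ≤? h̃ | exceeds e<h̃
      ... | yes X<h̃ | _        = X<h̃
      ... | no  X≮h̃ | k , refl = contradiction cond
        (reach⇒¬PrimeCond-α r k (excess-bound d e (suc k) (≤-pred (≰⇒> X≮h̃))))
      no-lower : ∀ h′ → 1 ≤ h′ → h′ < d + e → ¬ PrimeCond Y (d + e) h′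
      no-lower h′ 1≤h′ h′<X with h′ ≤? e
      ... | yes h′≤e = min h′ 1≤h′ (≤-<-trans h′≤e e<h̃) ∘ from (primeCond-α-short e h′≤e)
      ... | no  h′≰e with k , refl ← exceeds (≰⇒> h′≰e) =
        reach⇒¬PrimeCond r (suc k) (s≤s z≤n) (excess-bound d e (suc (suc k)) (subst (_≤ d + e) (sym (+-suc e (suc k))) h′<X))

    covers-α⇔ : ∀ {Y′ Ỹ′} → (∀ x → Ỹ′ x ≡ Y′ (predAbove d x)) → Covers Y′ Y ⇔ Covers Ỹ′ Ỹ
    covers-α⇔ {Y′} {Ỹ′} Ỹ′≗ = mk⇔ forth back
      where
      deleted⇔ : ∀ {X h X̃ h̃} → StripRel d X h X̃ h̃ → StripDeleted Y′ Y X h ⇔ StripDeleted Ỹ′ Ỹ X̃ h̃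
      deleted⇔ = stripDeleted-α⇔ Ỹ≗ Ỹ′≗

      forth : Covers Y′ Y → Covers Ỹ′ Ỹ
      forth (xB , h , 1≤xB , 1≤YxB , corner , hxB , del) with ≤-<-connex d xB
      ... | inj₂ xB<d = xB , h , 1≤xB , subst (1 ≤_) (sym (Ỹ-≤ xB≤d)) 1≤YxB ,
                        subst₂ _<_ (sym (Ỹ-≤ xB<d)) (sym (Ỹ-≤ xB≤d)) corner ,
                        PrimeHeight-cong (λ x x≤xB → sym (Ỹ-≤ (≤-trans x≤xB xB≤d))) hxB ,
                        to (deleted⇔ (stripRel-below xB<d)) del
        where xB≤d = <⇒≤ xB<d
      ... | inj₁ d≤xB with e , refl ← m≤n⇒∃[o]m+o≡n d≤xB with primeHeight-α-fwd e hxB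
      ...   | h̃ , hX̃ , rel = suc (d + e) , h̃ , s≤s z≤n , subst (1 ≤_) (sym (Ỹ-suc d≤xB)) 1≤YxB ,
                             subst₂ _<_ (sym (Ỹ-suc (≤-trans d≤xB (n≤1+n _)))) (sym (Ỹ-suc d≤xB)) corner ,
                             hX̃ , to (deleted⇔ rel) del

      back : Covers Ỹ′ Ỹ → Covers Y′ Y
      back (X̃ , h̃ , 1≤X̃ , 1≤ỸX̃ , corner , hX̃ , del) with <-cmp X̃ d
      ... | tri< X̃<d _ _ = X̃ , h̃ , 1≤X̃ , subst (1 ≤_) (Ỹ-≤ X̃≤d) 1≤ỸX̃ ,
                           subst₂ _<_ (Ỹ-≤ X̃<d) (Ỹ-≤ X̃≤d) corner ,
                           PrimeHeight-cong (λ x x≤X̃ → Ỹ-≤ (≤-trans x≤X̃ X̃≤d)) hX̃ ,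
                           from (deleted⇔ (stripRel-below X̃<d)) del
        where X̃≤d = <⇒≤ X̃<d
      ... | tri≈ _ refl _ = contradiction corner (<-irrefl (trans (Ỹ-suc ≤-refl) (sym (Ỹ-≤ ≤-refl))))
      back (suc X , h̃ , _ , 1≤ỸX̃ , corner , hX̃ , del) | tri> _ _ d<X̃
        with e , refl ← m≤n⇒∃[o]m+o≡n (≤-pred d<X̃) with primeHeight-α-bwd e hX̃
      ... | h , hX , rel = d + e , h , ≤-trans (>-nonZero⁻¹ d) (m≤m+n d e) , subst (1 ≤_) (Ỹ-suc d≤X) 1≤ỸX̃ ,
                           subst₂ _<_ (Ỹ-suc (≤-trans d≤X (n≤1+n _))) (Ỹ-suc d≤X) corner ,
                           hX , from (deleted⇔ rel) del
        where d≤X = m≤m+n d e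

-- ψ-tableaux

downwardInduction : ∀ (P : ℕ → Set) {n} → P n → (∀ r → r < n → P (suc r) → P r) → ∀ r → r ≤ n → P r
downwardInduction P {n} Pn step r r≤n with k , r+k≡n ← m≤n⇒∃[o]m+o≡n r≤n = go k r r+k≡n
  where
  go : ∀ k r → r + k ≡ n → P r
  go zero    r r+0≡n = subst P (trans (sym r+0≡n) (+-identityʳ r)) Pn
  go (suc k) r r+k≡n =
    step r (subst (r <_) r+k≡n (m<m+n r z<s)) (go k (suc r) (trans (sym (+-suc r k)) r+k≡n))

labels-≤-rowMax : ∀ r → All (_≤ rowMax r) r
labels-≤-rowMax []       = []
labels-≤-rowMax (a ∷ as) =
  m≤m⊔n a (rowMax as) ∷ All.map (λ b≤ → ≤-trans b≤ (m≤n⊔m a (rowMax as))) (labels-≤-rowMax as)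

labels-≤-len : ∀ T x → All (_≤ len T) (rowAt T x)
labels-≤-len []       x             = []
labels-≤-len (r ∷ rs) zero          = []
labels-≤-len (r ∷ rs) (suc zero)    rewrite len-∷ r rs =
  All.map (λ a≤ → ≤-trans a≤ (m≤m⊔n (rowMax r) (len rs))) (labels-≤-rowMax r)
labels-≤-len (r ∷ rs) (suc (suc x)) rewrite len-∷ r rs =
  All.map (λ a≤ → ≤-trans a≤ (m≤n⊔m (rowMax r) (len rs))) (labels-≤-len rs (suc x))

shapeUpTo-len : ∀ T x → shapeUpTo T (len T) x ≡ rowLen T x
shapeUpTo-len T x = cong length (filter-all (λ a → a ≤? len T) (labels-≤-len T x))

shapeUpTo-α : ∀ d .{{_ : NonZero d}} T r x → shapeUpTo (α d T) r x ≡ shapeUpTo T r (predAbove d x)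
shapeUpTo-α d T r x = cong (λ row → length (filter (λ a → a ≤? r) row)) (rowAt-α d T x)

module _ {d} .{{_ : NonZero d}} {T : RawTableau} (hT : PrimeHeight (rowLen T) d d) where

  private
    Height : ℕ → Set
    Height r = PrimeHeight (shapeUpTo T r) d d

    covers-step-α⇔ : ∀ r → Height (suc r) →
                     Covers (shapeUpTo T r) (shapeUpTo T (suc r))
                       ⇔ Covers (shapeUpTo (α d T) r) (shapeUpTo (α d T) (suc r))
    covers-step-α⇔ r h = covers-α⇔ h (shapeUpTo-α d T (suc r)) (shapeUpTo-α d T r)

    heights : (∀ r → r < len T → Height (suc r) → Covers (shapeUpTo T r) (shapeUpTo T (suc r))) →
              ∀ r → r ≤ len T → Height r
    heights covers = downwardInduction Height (PrimeHeight-cong (λ x _ → sym (shapeUpTo-len T x)) hT)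
                                        λ r r<l h → primeHeight-d-cover h (covers r r<l h)

  IsPsi-α⇔ : IsPsi T ⇔ IsPsi (α d T)
  IsPsi-α⇔ = mk⇔ forth back
    where
    forth : IsPsi T → IsPsi (α d T)
    forth ψ (suc r) _ r<l = to (covers-step-α⇔ r (heights (λ r r<l _ → ψ (suc r) (s≤s z≤n) r<l) (suc r) r<lT))
                              (ψ (suc r) (s≤s z≤n) r<lT)
      where r<lT = subst (suc r ≤_) (len-α d T) r<l
    back : IsPsi (α d T) → IsPsi T
    back ψ (suc r) _ r<l = covers r r<l (heights covers (suc r) r<l)
      where
      covers : ∀ r → r < len T → Height (suc r) → Covers (shapeUpTo T r) (shapeUpTo T (suc r))
      covers r r<l h =
        from (covers-step-α⇔ r h) (ψ (suc r) (s≤s z≤n) (subst (suc r ≤_) (sym (len-α d T)) r<l))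

theorem3p11 : (d : ℕ) → 1 ≤ d →
  -- α_d is a bijection 𝕏 → 𝕐_d with inverse β_d
  ( (∀ T → IsTableau T → IsTableau (α d T) × RowsIdentical (α d T) d)
  × (∀ T → IsTableau T → RowsIdentical T d → IsTableau (β d T) × α d (β d T) ≡ T)
  × (∀ T → IsTableau T → β d (α d T) ≡ T) )
  ×
  (∀ T → IsTableau T →
    -- l(T) = l(α_d T), and row d has the same length b in both
    len (α d T) ≡ len T × rowLen (α d T) d ≡ rowLen T d
    -- (1)
    × ( (∀ x → 1 ≤ x → x ≤ d → rowAt T x ≡ rowAt (α d T) x)
      × (rowLen T d ≡ 0 ⇔ T ≡ α d T) )
    -- (2)
    × ( (∀ j → d ≤ j → rowAt T j ≡ rowAt (α d T) (suc j))
      × (∀ y → 1 ≤ y → y ≤ rowLen T d → colLen (α d T) y ≡ suc (colLen T y)) )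
    -- (3)
    × (0 < rowLen T d → ∀ xB yB xB′ yB′ →
         IsEndBox (LSet T (len T)) xB yB → IsEndBox (LSet (α d T) (len T)) xB′ yB′ →
           ( (xB < d ⇔ (xB ≡ xB′ × yB ≡ yB′))
           × ((xB ≡ xB′ × yB ≡ yB′) ⇔ SameSet (LSet T (len T)) (LSet (α d T) (len T))) )
         × (d ≤ xB ⇔ (xB′ ≡ suc xB × yB′ ≡ yB))
         × ( (BeginsAfter (LSet T (len T)) d ⇔ BeginsAfter (LSet (α d T) (len T)) (suc d))
           × (BeginsAfter (LSet (α d T) (len T)) (suc d)
                ⇔ SameSet (LSet (α d T) (len T)) (ShiftDown (LSet T (len T)))) )
         × (d ≤ xB →
             (SameSet (LSet T (len T)) (LastBoxesUpTo T xB)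
               ⇔ SameSet (LSet (α d T) (len T)) (LastBoxesUpTo (α d T) (suc xB)))))
    -- (4)
    × ( (PrimeHeight (rowLen T) d d ⇔ PrimeHeight (rowLen (α d T)) d d)
      × (PrimeHeight (rowLen T) d d → (IsPsi T ⇔ IsPsi (α d T))) ))
theorem3p11 zero    ()
theorem3p11 d@(suc _) _ =
  ( (λ T tab → IsTableau-α d T tab , α-rowsIdentical d T)
  , (λ T tab ident → IsTableau-β d T tab ident , α-β d T (IsTableau.rowsNonEmpty tab) ident)
  , (λ T _ → β-α d T) )
  , λ T tab →
      len-α d T , rowLen-α-≤ d T ≤-refl
    , ( (λ x _ x≤d → sym (rowAt-α-≤ d T x x≤d))
      , mk⇔ (sym ∘ α-emptyRow d T (IsTableau.rowsNonEmpty tab)) (α-fixed⇒emptyRow d T) )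
    , ( (λ j d≤j → sym (rowAt-α-suc d T j d≤j)) , colLen-α d T )
    , (λ _ _ _ _ _ endT endα →  -- (3) holds without the assumption b > 0
        let S̃≈ = LSet-α d T (len T)
            uniq = LSet-atMostOnePerRow (IsTableau-α d T tab) (len T)
        in ( endBox-below⇔fixed S̃≈ uniq endT endα , endBox-fixed⇔sameSet S̃≈ uniq endT endα )
         , endBox-above⇔shifted S̃≈ uniq endT endα
         , ( beginsAfter-α⇔ S̃≈
           , mk⇔ (beginsAfter-α⇒shiftDown S̃≈)
                 (shiftDown⇒beginsAfter-α S̃≈ (λ x → at? (rowAt (α d T) x) (len T)) (proj₁ endα)) )
         , λ d≤xB → SameSet-αSet⇔ d S̃≈ (LastBoxesUpTo-α d T d≤xB))
    , ( mk⇔ (PrimeHeight-cong (λ _ x≤d → sym (rowLen-α-≤ d T x≤d)))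
            (PrimeHeight-cong (λ _ x≤d → rowLen-α-≤ d T x≤d))
      , IsPsi-α⇔ )
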